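{- The set $\{A\subset\mathbb{N}: \Pr(\Pr(A))=A\}$ has the cardinality of the continuum.
   Context: For $m\in\mathbb{N}$, $D(m)$ is the set of positive divisors of $m$. For $A\subset\mathbb{N}$, $S_A=\sum_{a\in A}a$ ($S_\emptyset=0$, $S_A=+\infty$ for infinite $A$), and $A$ is a practical set if every non-negative integer $k\le S_A$ is a sum of distinct elements of $A$. A number $m\in\mathbb{N}$ is $A$-practical if $D(m)\cap A$ is a practical set, and $\Pr(A)$ is the set of all $A$-practical numbers. -}

module Defs where

open import Level using (0ℓ)
open import Data.Nat using (ℕ; _≤_; _<_)
open import Data.Nat.Divisibility using (_∣_)
open import Data.Bool using (Bool)
open import Data.List using (List)
open import Data.Nat.ListAction using (sum)
open import Data.List.Membership.Propositional using (_∈_)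
open import Data.List.Relation.Unary.Unique.Propositional using (Unique)
open import Data.List.Relation.Binary.Sublist.Propositional using (_⊆_)
open import Data.Product using (Σ; _×_; ∃)
open import Function.Bundles using (_⇔_)
open import Relation.Binary.PropositionalEquality using (_≡_)
open import Relation.Unary using (Pred)

-- Subsets of ℕ (intended: of the positive integers) are predicates.
Subset : Set₁
Subset = Pred ℕ 0ℓ

-- A finite set of naturals, presented by a duplicate-free list `L`, is
-- practical if every k ≤ S_L is a sum of distinct elements of L
-- (a sublist of a duplicate-free list = a set of distinct elements).
PracticalList : List ℕ → Set
PracticalList L = Unique L × (∀ k → k ≤ sum L → ∃ λ S → S ⊆ L × sum S ≡ k)

Enumerates : Subset → ℕ → List ℕ → Set
Enumerates A m L = Unique L × (∀ x → (x ∈ L) ⇔ ((x ∣ m) × A x))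

_-practical_ : Subset → ℕ → Set
A -practical m = (0 < m) × (∃ λ L → Enumerates A m L × PracticalList L)

Pr : Subset → Subset
Pr A m = A -practical m

_≐_ : Subset → Subset → Set
A ≐ B = ∀ m → A m ⇔ B m

module Submission where

-- Whether m ∈ Pr(A) depends only on A ∩ [1, m], and for the increasing list
-- d₁ < d₂ < … of D(m) ∩ A it is decided by Brown's criterion
-- dᵢ ≤ 1 + d₁ + … + dᵢ₋₁.  So a set α with Pr(Pr(α)) = α can be built by
-- deciding m ∈ α by recursion on m.  With α fixed below m, the value f(v) of
-- Pr(Pr(α)) at m when m ∈ α is set to v is a monotone function of v: adding the
-- largest divisor m can only violate the criterion, and Pr is applied twice.  A
-- monotone f : Bool → Bool satisfies f ∘ f = f, so m ∈ α :⇔ f(β m) works for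
-- any prescription β.  At a prime p > 2 the only smaller divisor is 1, which lies
-- in α and in Pr(α); then f is the identity and m ∈ α :⇔ β p.  Prescribing β
-- freely along a sequence of primes embeds the Cantor space.

open import Defs
open import Data.Bool using (Bool; true; false; not; _∧_; T)
open import Data.Bool.Properties using (T-∧; T-≡; ∧-assoc; ∧-identityʳ; ∧-zeroʳ; not-involutive)
open import Data.Empty using (⊥-elim)
open import Data.List using (List; []; _∷_; _++_; [_]; filter)
open import Data.List.Properties using (++-assoc; ++-identityʳ)
open import Data.List.Membership.Propositional using (_∈_)
open import Data.List.Membership.Propositional.Properties
  using (∈-++⁻; ∈-++⁺ˡ; ∈-++⁺ʳ; ∈-filter⁺; ∈-filter⁻)
open import Data.List.Membership.Propositional.Properties.WithK using (unique∧set⇒bag)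
open import Data.List.Relation.Binary.BagAndSetEquality using (∼bag⇒↭)
open import Data.List.Relation.Binary.Sublist.Propositional using (_⊆_; []; _∷_; _∷ʳ_; ⊆-refl)
open import Data.List.Relation.Binary.Sublist.Propositional.Properties
  using (++⁺; ++⁺ʳ; filter-⊆; All-resp-⊆; Any-resp-⊆)
open import Data.List.Relation.Unary.All as All using (All; []; _∷_)
open import Data.List.Relation.Unary.Any using (here; there)
open import Data.List.Relation.Unary.AllPairs as AllPairs using (AllPairs; []; _∷_)
import Data.List.Relation.Unary.AllPairs.Properties as AllPairs
open import Data.List.Relation.Unary.Unique.Propositional using (Unique)
import Data.List.Relation.Unary.Unique.Propositional.Properties as Unique
open import Data.Nat
open import Data.Nat.Properties
open import Data.Nat.Divisibility
  using (_∣_; _∣?_; ∣-refl; ∣-trans; ∣⇒≤; 1∣_; 0∣⇒≡0; ∣1⇒≡1; ∣m+n∣m⇒∣n; m∣m*n; m≤n⇒m!∣n!)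
open import Data.Nat.ListAction using (sum; product)
open import Data.Nat.ListAction.Properties using (sum-++; sum-↭; ∈⇒∣product)
open import Data.Nat.Primality using (Prime; prime⇒irreducible; ¬prime[1])
open import Data.Nat.Primality.Factorisation using (factorise; PrimeFactorisation)
open import Data.List.Membership.DecPropositional _≟_ using (_∈?_)
open import Data.Product using (Σ; ∃; _×_; _,_; proj₁; proj₂)
open import Data.Product.Function.NonDependent.Propositional using (_×-⇔_)
open import Data.Sum using (inj₁; inj₂)
open import Data.Unit using (tt)
open import Function using (_∘_)
open import Function.Bundles using (_⇔_; mk⇔; Equivalence)
import Function.Properties.Equivalence as ⇔
open import Relation.Binary.PropositionalEquality hiding ([_])
open import Relation.Nullary using (Dec; yes; no; does; ¬_)
open import Relation.Nullary.Decidable using (dec-true; dec-false)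

open Equivalence using (to; from)

antitone∘antitone : (g h : Bool → Bool) →
  (T (g true) → T (g false)) → (T (h true) → T (h false)) →
  T (g (h false)) → T (g (h true))
antitone∘antitone g h g↓ h↓ t with h true | h false
... | true  | true  = t
... | false | false = t
... | false | true  = g↓ t
... | true  | false = ⊥-elim (h↓ tt)

monotone⇒idempotent : (f : Bool → Bool) → (T (f false) → T (f true)) →
  ∀ b → f (f b) ≡ f b
monotone⇒idempotent f f↑ true with f true in ft
... | true  = ft
... | false with f false
...   | false = refl
...   | true  = ⊥-elim (f↑ tt)
monotone⇒idempotent f f↑ false with f false in ff
... | false = ff
... | true with f true
...   | true  = refl
...   | false = ⊥-elim (f↑ tt)

T-injective : ∀ {b c} → T b ⇔ T c → b ≡ c
T-injective {false} {false} _ = refl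
T-injective {true}  {true}  _ = refl
T-injective {false} {true}  b⇔c = ⊥-elim (from b⇔c tt)
T-injective {true}  {false} b⇔c = ⊥-elim (to b⇔c tt)

module _ {A : Set} where

  update : (ℕ → A) → ℕ → A → ℕ → A
  update a n v d with d ≟ n
  ... | yes _ = v
  ... | no  _ = a d

  update-≡ : ∀ a n v → update a n v n ≡ v
  update-≡ a n v with n ≟ n
  ... | yes _   = refl
  ... | no  n≢n = ⊥-elim (n≢n refl)

  update-≢ : ∀ a {n} v {d} → d ≢ n → update a n v d ≡ a d
  update-≢ a {n} v {d} d≢n with d ≟ n
  ... | yes d≡n = ⊥-elim (d≢n d≡n)
  ... | no  _   = refl

  update-self : ∀ a n d → update a n (a n) d ≡ a d
  update-self a n d with d ≟ n
  ... | yes refl = refl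
  ... | no  _    = refl

  AgreeBelow : ℕ → (ℕ → A) → (ℕ → A) → Set
  AgreeBelow n a b = ∀ {d} → d < n → a d ≡ b d

  update-agreeBelow : ∀ a {n} v → AgreeBelow n (update a n v) a
  update-agreeBelow a v d<n = update-≢ a v (<⇒≢ d<n)

  update-cong : ∀ {a b n} v → AgreeBelow n a b → AgreeBelow (suc n) (update a n v) (update b n v)
  update-cong {a} {b} {n} v a≈b {d} d<1+n with m<1+n⇒m<n∨m≡n d<1+n
  ... | inj₁ d<n  =
    trans (update-agreeBelow a v d<n) (trans (a≈b d<n) (sym (update-agreeBelow b v d<n)))
  ... | inj₂ refl = trans (update-≡ a n v) (sym (update-≡ b n v))

-- Brown's criterion for complete sequences

brown : ℕ → List ℕ → Bool
brown s []       = true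
brown s (x ∷ xs) = (x ≤ᵇ suc s) ∧ brown (s + x) xs

brown-++ : ∀ s xs ys → brown s (xs ++ ys) ≡ brown s xs ∧ brown (s + sum xs) ys
brown-++ s []       ys = cong (λ t → brown t ys) (sym (+-identityʳ s))
brown-++ s (x ∷ xs) ys = begin
  (x ≤ᵇ suc s) ∧ brown (s + x) (xs ++ ys)
    ≡⟨ cong ((x ≤ᵇ suc s) ∧_) (brown-++ (s + x) xs ys) ⟩
  (x ≤ᵇ suc s) ∧ (brown (s + x) xs ∧ brown (s + x + sum xs) ys)
    ≡⟨ sym (∧-assoc (x ≤ᵇ suc s) _ _) ⟩
  ((x ≤ᵇ suc s) ∧ brown (s + x) xs) ∧ brown (s + x + sum xs) ys
    ≡⟨ cong (λ t → ((x ≤ᵇ suc s) ∧ brown (s + x) xs) ∧ brown t ys) (+-assoc s x (sum xs)) ⟩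
  ((x ≤ᵇ suc s) ∧ brown (s + x) xs) ∧ brown (s + (x + sum xs)) ys ∎
  where open ≡-Reasoning

brown-prefix : ∀ s xs ys → T (brown s (xs ++ ys)) → T (brown s xs)
brown-prefix s xs ys = proj₁ ∘ to T-∧ ∘ subst T (brown-++ s xs ys)

brown-intro : ∀ s xs → (∀ ys x zs → xs ≡ ys ++ x ∷ zs → x ≤ suc (s + sum ys)) →
  T (brown s xs)
brown-intro s []       _    = tt
brown-intro s (x ∷ xs) gaps = from T-∧ (≤⇒≤ᵇ x≤1+s , brown-intro (s + x) xs gaps′)
  where
  x≤1+s : x ≤ suc s
  x≤1+s = subst (λ t → x ≤ suc t) (+-identityʳ s) (gaps [] x xs refl)
  gaps′ : ∀ ys y zs → xs ≡ ys ++ y ∷ zs → y ≤ suc (s + x + sum ys)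
  gaps′ ys y zs eq = subst (λ t → y ≤ suc t) (sym (+-assoc s x (sum ys)))
    (gaps (x ∷ ys) y zs (cong (x ∷_) eq))

SubsetSum : List ℕ → ℕ → Set
SubsetSum L k = ∃ λ S → S ⊆ L × sum S ≡ k

Complete : List ℕ → Set
Complete L = ∀ k → k ≤ sum L → SubsetSum L k

sum-snoc : ∀ xs x → sum (xs ++ [ x ]) ≡ sum xs + x
sum-snoc xs x = trans (sum-++ xs [ x ]) (cong (sum xs +_) (+-identityʳ x))

complete-[] : Complete []
complete-[] zero z≤n = [] , [] , refl

complete-snoc : ∀ {B x} → Complete B → x ≤ suc (sum B) → Complete (B ++ [ x ])
complete-snoc {B} {x} complete x≤1+B k k≤ with k ≤? sum B
... | yes k≤B = let (S , S⊆B , ΣS≡k) = complete k k≤B in S , ++⁺ʳ [ x ] S⊆B , ΣS≡k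
... | no  k≰B with complete (k ∸ x) (m≤n+o⇒m∸n≤o k x k≤x+B)
  where
  k≤x+B : k ≤ x + sum B
  k≤x+B = subst (k ≤_) (trans (sum-snoc B x) (+-comm (sum B) x)) k≤
...   | S , S⊆B , ΣS≡k∸x = S ++ [ x ] , ++⁺ S⊆B ⊆-refl , (begin
  sum (S ++ [ x ]) ≡⟨ sum-snoc S x ⟩
  sum S + x        ≡⟨ cong (_+ x) ΣS≡k∸x ⟩
  k ∸ x + x        ≡⟨ m∸n+n≡m (≤-trans x≤1+B (≰⇒> k≰B)) ⟩
  k                ∎)
  where open ≡-Reasoning

brown⇒complete : ∀ B xs → Complete B → T (brown (sum B) xs) → Complete (B ++ xs)
brown⇒complete B []       complete _ = subst Complete (sym (++-identityʳ B)) complete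
brown⇒complete B (x ∷ xs) complete t = subst Complete (++-assoc B [ x ] xs)
  (brown⇒complete (B ++ [ x ]) xs (complete-snoc complete (≤ᵇ⇒≤ x _ x≤)) t′)
  where
  x≤ = proj₁ (to T-∧ t)
  t′ : T (brown (sum (B ++ [ x ])) xs)
  t′ = subst (λ s → T (brown s xs)) (sym (sum-snoc B x)) (proj₂ (to T-∧ t))

brown⇒practical : ∀ {L} → Unique L → T (brown 0 L) → PracticalList L
brown⇒practical {L} unique t = unique , brown⇒complete [] L complete-[] t

AllPairs-resp-⊆ : ∀ {R : ℕ → ℕ → Set} {xs ys} → xs ⊆ ys → AllPairs R ys → AllPairs R xs
AllPairs-resp-⊆ []         []         = []
AllPairs-resp-⊆ (_ ∷ʳ xs⊆) (_ ∷ rys)  = AllPairs-resp-⊆ xs⊆ rys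
AllPairs-resp-⊆ (refl ∷ xs⊆) (rx ∷ rys) = All-resp-⊆ xs⊆ rx ∷ AllPairs-resp-⊆ xs⊆ rys

sublist⇒sum≤ : ∀ {xs ys} → xs ⊆ ys → sum xs ≤ sum ys
sublist⇒sum≤ []           = z≤n
sublist⇒sum≤ (y ∷ʳ xs⊆)   = ≤-trans (sublist⇒sum≤ xs⊆) (m≤n+m _ y)
sublist⇒sum≤ (refl ∷ xs⊆) = +-monoʳ-≤ _ (sublist⇒sum≤ xs⊆)

unique∧subset⇒sum≤ : ∀ {xs ys} → Unique xs → Unique ys → (∀ {e} → e ∈ xs → e ∈ ys) →
  sum xs ≤ sum ys
unique∧subset⇒sum≤ {xs} {ys} uxs uys xs⊆ys = begin
  sum xs
    ≡⟨ sum-↭ (∼bag⇒↭ (unique∧set⇒bag uxs (Unique.filter⁺ (_∈? xs) uys) (mk⇔ ⊆filter filter⊆))) ⟩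
  sum (filter (_∈? xs) ys) ≤⟨ sublist⇒sum≤ (filter-⊆ (_∈? xs) ys) ⟩
  sum ys                   ∎
  where
  open ≤-Reasoning
  ⊆filter : ∀ {e} → e ∈ xs → e ∈ filter (_∈? xs) ys
  ⊆filter e∈xs = ∈-filter⁺ (_∈? xs) (xs⊆ys e∈xs) e∈xs
  filter⊆ : ∀ {e} → e ∈ filter (_∈? xs) ys → e ∈ xs
  filter⊆ = proj₂ ∘ ∈-filter⁻ (_∈? xs) {xs = ys}

∈⇒≤sum : ∀ {e xs} → e ∈ xs → e ≤ sum xs
∈⇒≤sum {xs = x ∷ xs} (here refl) = m≤m+n x (sum xs)
∈⇒≤sum {xs = x ∷ xs} (there e∈xs) = ≤-trans (∈⇒≤sum e∈xs) (m≤n+m (sum xs) x)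

∈-below : ∀ ys {x zs e} → AllPairs _<_ (ys ++ x ∷ zs) → e ∈ ys ++ x ∷ zs → e < x → e ∈ ys
∈-below []       (x<zs ∷ _) (here refl)  e<x = ⊥-elim (<-irrefl refl e<x)
∈-below []       (x<zs ∷ _) (there e∈zs) e<x = ⊥-elim (<-asym e<x (All.lookup x<zs e∈zs))
∈-below (y ∷ ys) _          (here refl)  e<x = here refl
∈-below (y ∷ ys) (_ ∷ inc)  (there e∈)   e<x = there (∈-below ys inc e∈ e<x)

DistinctSums : List ℕ → Set
DistinctSums C = ∀ k → k ≤ sum C → ∃ λ S → Unique S × (∀ {e} → e ∈ S → e ∈ C) × sum S ≡ k

gap-bound : ∀ ys {x zs} → AllPairs _<_ (ys ++ x ∷ zs) → DistinctSums (ys ++ x ∷ zs) →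
  x ≤ suc (sum ys)
gap-bound ys {x} {zs} inc sums with x ≤? suc (sum ys)
... | yes x≤ = x≤
... | no  x≰ with sums (suc (sum ys)) (≤-trans (<⇒≤ 1+ys<x) (∈⇒≤sum (∈-++⁺ʳ ys (here refl))))
  where
  1+ys<x : suc (sum ys) < x
  1+ys<x = ≰⇒> x≰
...   | S , uS , S⊆C , ΣS≡1+ys = ⊥-elim (1+n≰n (subst (_≤ sum ys) ΣS≡1+ys ΣS≤ys))
  where
  S⊆ys : ∀ {e} → e ∈ S → e ∈ ys
  S⊆ys e∈S = ∈-below ys inc (S⊆C e∈S) (≤-<-trans (subst (_ ≤_) ΣS≡1+ys (∈⇒≤sum e∈S)) (≰⇒> x≰))
  ΣS≤ys : sum S ≤ sum ys
  ΣS≤ys = unique∧subset⇒sum≤ uS (AllPairs.map <⇒≢ (AllPairs-resp-⊆ (++⁺ʳ (x ∷ zs) ⊆-refl) inc)) S⊆ys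

complete⇒brown : ∀ {C} → AllPairs _<_ C → DistinctSums C → T (brown 0 C)
complete⇒brown {C} inc sums = brown-intro 0 C λ where
  ys x zs refl → gap-bound ys inc sums

practical⇒distinctSums : ∀ {L C} → PracticalList L → Unique C →
  (∀ {x} → x ∈ L ⇔ x ∈ C) → DistinctSums C
practical⇒distinctSums {L} {C} (uL , complete) uC L⇔C k k≤C
  with complete k (≤-trans k≤C (unique∧subset⇒sum≤ uC uL (from L⇔C)))
... | S , S⊆L , ΣS≡k = S , AllPairs-resp-⊆ S⊆L uL , to L⇔C ∘ Any-resp-⊆ S⊆L , ΣS≡k

singletonIf : Bool → ℕ → List ℕ
singletonIf true  d = [ d ]
singletonIf false d = []

∈-singletonIf : ∀ {b d x} → x ∈ singletonIf b d → T b × x ≡ d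
∈-singletonIf {true} (here refl) = tt , refl

singletonIf-∈ : ∀ {b} d → T b → d ∈ singletonIf b d
singletonIf-∈ {true} d _ = here refl

singletonIf-All : ∀ {P : ℕ → Set} b {d} → P d → All P (singletonIf b d)
singletonIf-All true  pd = pd ∷ []
singletonIf-All false _  = []

singletonIf-AllPairs : ∀ {R : ℕ → ℕ → Set} b d → AllPairs R (singletonIf b d)
singletonIf-AllPairs true  d = [] ∷ []
singletonIf-AllPairs false d = []

divisorsIn : (ℕ → Bool) → ℕ → ℕ → List ℕ
divisorsIn a m zero    = []
divisorsIn a m (suc j) = divisorsIn a m j ++ singletonIf (a (suc j) ∧ does (suc j ∣? m)) (suc j)

T-does : ∀ {P : Set} (P? : Dec P) → T (does P?) ⇔ P
T-does (yes p) = mk⇔ (λ _ → p) (λ _ → tt)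
T-does (no ¬p) = mk⇔ (λ ()) ¬p

T-∧-∣? : ∀ {b d m} → T (b ∧ does (d ∣? m)) ⇔ (T b × d ∣ m)
T-∧-∣? {d = d} {m} = ⇔.trans T-∧ (⇔.refl ×-⇔ T-does (d ∣? m))

∈-divisorsIn⁻ : ∀ a m j {x} → x ∈ divisorsIn a m j → 0 < x × x ≤ j × T (a x) × x ∣ m
∈-divisorsIn⁻ a m (suc j) x∈ with ∈-++⁻ (divisorsIn a m j) x∈
... | inj₁ x∈′ =
  let (0<x , x≤j , ax , x∣m) = ∈-divisorsIn⁻ a m j x∈′ in 0<x , m≤n⇒m≤1+n x≤j , ax , x∣m
... | inj₂ x∈′ with ∈-singletonIf x∈′
...   | t , refl = z<s , ≤-refl , to T-∧-∣? t

divisorsIn-∈⁺ : ∀ a m j {x} → 0 < x → x ≤ j → T (a x) → x ∣ m → x ∈ divisorsIn a m j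
divisorsIn-∈⁺ a m zero    {suc x} 0<x ()
divisorsIn-∈⁺ a m (suc j) 0<x x≤1+j ax x∣m with m≤n⇒m<n∨m≡n x≤1+j
... | inj₁ x<1+j = ∈-++⁺ˡ (divisorsIn-∈⁺ a m j 0<x (m<1+n⇒m≤n x<1+j) ax x∣m)
... | inj₂ refl  = ∈-++⁺ʳ (divisorsIn a m j) (singletonIf-∈ (suc j) (from T-∧-∣? (ax , x∣m)))

∈-divisorsIn-self : ∀ a k {x} → x ∈ divisorsIn a (suc k) (suc k) ⇔ (x ∣ suc k × T (a x))
∈-divisorsIn-self a k = mk⇔
  (λ x∈ → let (_ , _ , ax , x∣m) = ∈-divisorsIn⁻ a (suc k) (suc k) x∈ in x∣m , ax)
  (λ (x∣m , ax) → divisorsIn-∈⁺ a (suc k) (suc k) (positive x∣m) (∣⇒≤ x∣m) ax x∣m)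
  where
  positive : ∀ {x} → x ∣ suc k → 0 < x
  positive {zero}  0∣m with () ← 0∣⇒≡0 0∣m
  positive {suc x} _ = z<s

divisorsIn-increasing : ∀ a m j → AllPairs _<_ (divisorsIn a m j)
divisorsIn-increasing a m zero    = []
divisorsIn-increasing a m (suc j) =
  AllPairs.++⁺ (divisorsIn-increasing a m j) (singletonIf-AllPairs _ (suc j))
    (All.tabulate λ x∈ → singletonIf-All _ (s≤s (proj₁ (proj₂ (∈-divisorsIn⁻ a m j x∈)))))

divisorsIn-local : ∀ {a b} m j → AgreeBelow (suc j) a b → divisorsIn a m j ≡ divisorsIn b m j
divisorsIn-local m zero    _   = refl
divisorsIn-local m (suc j) a≈b = cong₂ _++_
  (divisorsIn-local m j (a≈b ∘ m<n⇒m<1+n))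
  (cong (λ t → singletonIf (t ∧ does (suc j ∣? m)) (suc j)) (a≈b ≤-refl))

Prᵇ : (ℕ → Bool) → ℕ → Bool
Prᵇ a zero    = false
Prᵇ a (suc k) = brown 0 (divisorsIn a (suc k) (suc k))

Pr⇔Prᵇ : ∀ {A : Subset} {a} → (∀ n → A n ⇔ T (a n)) → ∀ m → Pr A m ⇔ T (Prᵇ a m)
Pr⇔Prᵇ A⇔a zero = mk⇔ (λ ()) (λ ())
Pr⇔Prᵇ {A} {a} A⇔a (suc k) = mk⇔
  (λ (_ , L , (_ , L⇔) , practical) → complete⇒brown increasing
    (practical⇒distinctSums practical unique (⇔.trans (L⇔ _) (⇔.sym (C⇔ _)))))
  (λ t → z<s , C , (unique , C⇔) , brown⇒practical unique t)
  where
  C = divisorsIn a (suc k) (suc k)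
  increasing = divisorsIn-increasing a (suc k) (suc k)
  unique = AllPairs.map <⇒≢ increasing
  C⇔ : ∀ x → x ∈ C ⇔ (x ∣ suc k × A x)
  C⇔ x = ⇔.trans (∈-divisorsIn-self a k) (⇔.refl ×-⇔ ⇔.sym (A⇔a x))

Prᵇ-local : ∀ {a b} m → AgreeBelow (suc m) a b → Prᵇ a m ≡ Prᵇ b m
Prᵇ-local zero    _   = refl
Prᵇ-local (suc k) a≈b = cong (brown 0) (divisorsIn-local (suc k) (suc k) a≈b)

Prᵇ²-local : ∀ {a b} m → AgreeBelow (suc m) a b → Prᵇ (Prᵇ a) m ≡ Prᵇ (Prᵇ b) m
Prᵇ²-local m a≈b = Prᵇ-local m λ {d} d<1+m → Prᵇ-local d λ e<1+d → a≈b (≤-trans e<1+d d<1+m)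

Prᵇ-one : ∀ a → T (Prᵇ a 1)
Prᵇ-one a with a 1
... | true  = tt
... | false = tt

Prᵇ-top : ∀ a k →
  Prᵇ a (suc k) ≡ brown 0 (divisorsIn a (suc k) k ++ singletonIf (a (suc k)) (suc k))
Prᵇ-top a k = cong (λ t → brown 0 (divisorsIn a (suc k) k ++ singletonIf t (suc k)))
  (trans (cong (a (suc k) ∧_) (dec-true (suc k ∣? suc k) ∣-refl)) (∧-identityʳ (a (suc k))))

Prᵇ-update : ∀ a k v →
  Prᵇ (update a (suc k) v) (suc k) ≡ brown 0 (divisorsIn a (suc k) k ++ singletonIf v (suc k))
Prᵇ-update a k v = trans (Prᵇ-top (update a (suc k) v) k)
  (cong₂ (λ C b → brown 0 (C ++ singletonIf b (suc k)))
    (divisorsIn-local (suc k) k (update-agreeBelow a v)) (update-≡ a (suc k) v))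

-- Making m a member only appends m to the list of divisors, since m is the largest.
Prᵇ-update-antitone : ∀ a m → T (Prᵇ (update a m true) m) → T (Prᵇ (update a m false) m)
Prᵇ-update-antitone a zero    ()
Prᵇ-update-antitone a (suc k) t
  rewrite Prᵇ-update a k false | ++-identityʳ (divisorsIn a (suc k) k) =
  brown-prefix 0 (divisorsIn a (suc k) k) [ suc k ] (subst T (Prᵇ-update a k true) t)

divisorsIn-prime : ∀ {p} a → Prime p → T (a 1) → ∀ j → 0 < j → j < p → divisorsIn a p j ≡ [ 1 ]
divisorsIn-prime {p} a _ a1 1 _ _ =
  cong (λ b → singletonIf b 1) (to T-≡ (from T-∧-∣? (a1 , 1∣ p)))
divisorsIn-prime {p} a p-prime a1 (suc (suc i)) _ 2+i<p = cong₂ _++_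
  (divisorsIn-prime a p-prime a1 (suc i) z<s (<-trans (n<1+n (suc i)) 2+i<p))
  (cong (λ b → singletonIf b (suc (suc i)))
    (trans (cong (a (suc (suc i)) ∧_) (dec-false (suc (suc i) ∣? p) 2+i∤p)) (∧-zeroʳ _)))
  where
  2+i∤p : ¬ suc (suc i) ∣ p
  2+i∤p 2+i∣p with prime⇒irreducible p-prime 2+i∣p
  ... | inj₂ refl = <-irrefl refl 2+i<p

Prᵇ-prime : ∀ {p} a → Prime p → 2 < p → T (a 1) → Prᵇ a p ≡ not (a p)
Prᵇ-prime {suc (suc (suc k))} a p-prime (s<s (s<s (s<s _))) a1 = begin
  Prᵇ a p                                         ≡⟨ Prᵇ-top a (suc (suc k)) ⟩
  brown 0 (divisorsIn a p (suc (suc k)) ++ singletonIf (a p) p)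
    ≡⟨ cong (λ C → brown 0 (C ++ singletonIf (a p) p))
         (divisorsIn-prime a p-prime a1 (suc (suc k)) z<s ≤-refl) ⟩
  brown 0 (1 ∷ singletonIf (a p) p)               ≡⟨ brown-1∷ (a p) ⟩
  not (a p)                                       ∎
  where
  open ≡-Reasoning
  p = suc (suc (suc k))
  brown-1∷ : ∀ b → brown 0 (1 ∷ singletonIf b p) ≡ not b
  brown-1∷ true  = refl
  brown-1∷ false = refl

response : (ℕ → Bool) → ℕ → Bool → Bool
response a n v = Prᵇ (Prᵇ (update a n v)) n

response-local : ∀ {a b} n v → AgreeBelow n a b → response a n v ≡ response b n v
response-local n v a≈b = Prᵇ²-local n (update-cong v a≈b)

Prᵇ-update-agreeBelow : ∀ a n v → AgreeBelow n (Prᵇ (update a n v)) (Prᵇ a)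
Prᵇ-update-agreeBelow a n v {d} d<n =
  Prᵇ-local d λ e<1+d → update-agreeBelow a v (≤-<-trans (m<1+n⇒m≤n e<1+d) d<n)

response-factors : ∀ a n v → response a n v ≡ Prᵇ (update (Prᵇ a) n (Prᵇ (update a n v) n)) n
response-factors a n v = Prᵇ-local n λ {d} d<1+n → sym (update-≡-below d<1+n)
  where
  update-≡-below : ∀ {d} → d < suc n →
    update (Prᵇ a) n (Prᵇ (update a n v) n) d ≡ Prᵇ (update a n v) d
  update-≡-below {d} d<1+n with m<1+n⇒m<n∨m≡n d<1+n
  ... | inj₁ d<n  = trans (update-agreeBelow (Prᵇ a) _ d<n) (sym (Prᵇ-update-agreeBelow a n v d<n))
  ... | inj₂ refl = update-≡ (Prᵇ a) n _

response-monotone : ∀ a n → T (response a n false) → T (response a n true)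
response-monotone a n t = subst T (sym (response-factors a n true))
  (antitone∘antitone (λ w → Prᵇ (update (Prᵇ a) n w) n) (λ v → Prᵇ (update a n v) n)
    (Prᵇ-update-antitone (Prᵇ a) n) (Prᵇ-update-antitone a n)
    (subst T (response-factors a n false) t))

response-prime : ∀ {p} a v → Prime p → 2 < p → T (a 1) → response a p v ≡ v
response-prime {p} a v p-prime 2<p a1 = begin
  Prᵇ (Prᵇ (update a p v)) p
    ≡⟨ Prᵇ-prime (Prᵇ (update a p v)) p-prime 2<p (Prᵇ-one (update a p v)) ⟩
  not (Prᵇ (update a p v) p)     ≡⟨ cong not (Prᵇ-prime (update a p v) p-prime 2<p a1′) ⟩
  not (not (update a p v p))     ≡⟨ cong (not ∘ not) (update-≡ a p v) ⟩
  not (not v)                    ≡⟨ not-involutive v ⟩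
  v                              ∎
  where
  open ≡-Reasoning
  a1′ : T (update a p v 1)
  a1′ = subst T (sym (update-agreeBelow a v (<-trans (s<s z<s) 2<p))) a1

module _ {A : Set} (default : A) (step : (ℕ → A) → ℕ → A) where

  approximant : ℕ → ℕ → A
  approximant zero    = λ _ → default
  approximant (suc n) = update (approximant n) n (step (approximant n) n)

  courseOfValues : ℕ → A
  courseOfValues n = step (approximant n) n

  approximant-agreeBelow : ∀ n → AgreeBelow n (approximant n) courseOfValues
  approximant-agreeBelow (suc n) {d} d<1+n with m<1+n⇒m<n∨m≡n d<1+n
  ... | inj₁ d<n  = trans (update-agreeBelow (approximant n) _ d<n) (approximant-agreeBelow n d<n)
  ... | inj₂ refl = update-≡ (approximant n) n _

  courseOfValues-unfold : (∀ {a b} n → AgreeBelow n a b → step a n ≡ step b n) →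
    ∀ n → courseOfValues n ≡ step courseOfValues n
  courseOfValues-unfold step-local n = step-local n (approximant-agreeBelow n)

Pr²-fixed : (ℕ → Bool) → ℕ → Bool
Pr²-fixed β = courseOfValues false λ a n → response a n (β n)

Pr²-fixed-unfold : ∀ β n → Pr²-fixed β n ≡ response (Pr²-fixed β) n (β n)
Pr²-fixed-unfold β = courseOfValues-unfold false _ λ n → response-local n (β n)

Prᵇ²-Pr²-fixed : ∀ β n → Prᵇ (Prᵇ (Pr²-fixed β)) n ≡ Pr²-fixed β n
Prᵇ²-Pr²-fixed β n = begin
  Prᵇ (Prᵇ α) n               ≡⟨ Prᵇ²-local n (λ {d} _ → sym (update-self α n d)) ⟩
  response α n (α n)          ≡⟨ cong (response α n) (Pr²-fixed-unfold β n) ⟩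
  response α n (response α n (β n))
    ≡⟨ monotone⇒idempotent (response α n) (response-monotone α n) (β n) ⟩
  response α n (β n)          ≡⟨ sym (Pr²-fixed-unfold β n) ⟩
  α n                         ∎
  where
  open ≡-Reasoning
  α = Pr²-fixed β

Pr²-fixed-prime : ∀ β {p} → Prime p → 2 < p → Pr²-fixed β p ≡ β p
Pr²-fixed-prime β {p} p-prime 2<p =
  trans (Pr²-fixed-unfold β p) (response-prime (Pr²-fixed β) (β p) p-prime 2<p α1)
  where
  α1 : T (Pr²-fixed β 1)
  α1 = subst T (Prᵇ²-Pr²-fixed β 1) (Prᵇ-one (Prᵇ (Pr²-fixed β)))

prime∣1+n!⇒n<p : ∀ {p n} → Prime p → p ∣ suc (n !) → n < p
prime∣1+n!⇒n<p {p} {n} p-prime p∣1+n! with n <? p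
... | yes n<p = n<p
... | no  n≮p = ⊥-elim (¬prime[1] (subst Prime (∣1⇒≡1 p∣1) p-prime))
  where
  p∣p! : ∀ {p} → Prime p → p ∣ p !
  p∣p! {suc p} _ = m∣m*n (p !)
  p∣1 : p ∣ 1
  p∣1 = ∣m+n∣m⇒∣n (subst (p ∣_) (+-comm 1 (n !)) p∣1+n!)
    (∣-trans (p∣p! p-prime) (m≤n⇒m!∣n! (≮⇒≥ n≮p)))

prime-above : ∀ n → ∃ λ p → Prime p × n < p
prime-above n = go factors isFactorisation factorsPrime
  where
  open PrimeFactorisation (factorise (suc (n !)))
  go : ∀ ps → suc (n !) ≡ product ps → All Prime ps → ∃ λ p → Prime p × n < p
  go []      1+n!≡1 _              with () ← subst (1 ≤_) (suc-injective 1+n!≡1) (1≤n! n)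
  go (p ∷ ps) 1+n!≡p* (p-prime ∷ _) =
    p , p-prime ,
    prime∣1+n!⇒n<p p-prime (subst (p ∣_) (sym 1+n!≡p*) (∈⇒∣product {ns = p ∷ ps} (here refl)))

nextPrime : ℕ → ℕ
nextPrime n = proj₁ (prime-above n)

oddPrime : ℕ → ℕ
oddPrime zero    = nextPrime 2
oddPrime (suc n) = nextPrime (oddPrime n)

oddPrime-prime : ∀ n → Prime (oddPrime n)
oddPrime-prime zero    = proj₁ (proj₂ (prime-above 2))
oddPrime-prime (suc n) = proj₁ (proj₂ (prime-above (oddPrime n)))

oddPrime-< : ∀ n → oddPrime n < oddPrime (suc n)
oddPrime-< n = proj₂ (proj₂ (prime-above (oddPrime n)))

2<oddPrime : ∀ n → 2 < oddPrime n
2<oddPrime zero    = proj₂ (proj₂ (prime-above 2))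
2<oddPrime (suc n) = <-trans (2<oddPrime n) (oddPrime-< n)

leftInverse : (q : ℕ → ℕ) → (∀ n → q n < q (suc n)) → Σ (ℕ → ℕ) λ r → ∀ n → r (q n) ≡ n
leftInverse q q-step = (λ m → search m (suc m)) , λ n → search-q (s≤s (n≤q n))
  where
  q-< : ∀ {m n} → m < n → q m < q n
  q-< {m} {suc n} m<1+n with m<1+n⇒m<n∨m≡n m<1+n
  ... | inj₁ m<n  = <-trans (q-< m<n) (q-step n)
  ... | inj₂ refl = q-step m
  n≤q : ∀ n → n ≤ q n
  n≤q zero    = z≤n
  n≤q (suc n) = ≤-trans (s≤s (n≤q n)) (q-step n)
  search : ℕ → ℕ → ℕ
  search m zero    = 0
  search m (suc j) with q j ≟ m
  ... | yes _ = j
  ... | no  _ = search m j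
  search-q : ∀ {n j} → n < j → search (q n) j ≡ n
  search-q {n} {suc j} n<1+j with q j ≟ q n | m<1+n⇒m<n∨m≡n n<1+j
  ... | yes qj≡qn | inj₁ n<j  = ⊥-elim (<-irrefl (sym qj≡qn) (q-< n<j))
  ... | yes _     | inj₂ refl = refl
  ... | no  _     | inj₁ n<j  = search-q n<j
  ... | no  qn≢qn | inj₂ refl = ⊥-elim (qn≢qn refl)

theorem4p16 : Σ ((ℕ → Bool) → Subset) λ F →
    ((f : ℕ → Bool) → Pr (Pr (F f)) ≐ F f) ×
    ((f g : ℕ → Bool) → F f ≐ F g → (n : ℕ) → f n ≡ g n)
theorem4p16 = F , Pr²-F , F-injective
  where
  index = proj₁ (leftInverse oddPrime oddPrime-<)
  index-oddPrime = proj₂ (leftInverse oddPrime oddPrime-<)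

  α : (ℕ → Bool) → ℕ → Bool
  α f = Pr²-fixed (f ∘ index)

  F : (ℕ → Bool) → Subset
  F f m = T (α f m)

  Pr²-F : (f : ℕ → Bool) → Pr (Pr (F f)) ≐ F f
  Pr²-F f m = subst (λ b → Pr (Pr (F f)) m ⇔ T b) (Prᵇ²-Pr²-fixed (f ∘ index) m)
    (Pr⇔Prᵇ (Pr⇔Prᵇ λ _ → ⇔.refl) m)

  α-oddPrime : ∀ f n → α f (oddPrime n) ≡ f n
  α-oddPrime f n = trans (Pr²-fixed-prime (f ∘ index) (oddPrime-prime n) (2<oddPrime n))
    (cong f (index-oddPrime n))

  F-injective : (f g : ℕ → Bool) → F f ≐ F g → (n : ℕ) → f n ≡ g n
  F-injective f g Ff≐Fg n = begin
    f n                ≡⟨ sym (α-oddPrime f n) ⟩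
    α f (oddPrime n)   ≡⟨ T-injective (Ff≐Fg (oddPrime n)) ⟩
    α g (oddPrime n)   ≡⟨ α-oddPrime g n ⟩
    g n                ∎
    where open ≡-Reasoning
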